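{- Let $T$ be any ABT, $t$ a vertex of $T$ with $\mathrm{dist}^{\beta}(t)<\infty$, and $e=\{y,t\}$ any edge of $G^+$ incident to $t$ that is not in $T$. Then $e$ has strictly larger level than $e^*_T(t)$, unless both $e\notin\mathsf{EP}(t)$ and $\rho(e)=\alpha(t)$ hold. In particular, if $e\notin\mathsf{EP}(t)$ and $\rho(e)=\beta(t)$, then $\mathsf{vlevel}(e)>\mathsf{vlevel}(e^*_T(t))$.
   Context: $G$ finite simple graph, $M$ a matching, $U$ the $M$-uncovered vertices. $G^+$: add vertex $f$ and for each $u\in U$ a vertex $w_u$ with edges $\{f,w_u\},\{w_u,u\}$; $M^+=M\cup\{\{w_u,u\}\}$. Alternating path: simple path in $G^+$ alternating between $M^+$ and non-$M^+$ edges. $\mathrm{dist}^\theta(v)$: minimum length of an alternating $f$–$v$ path of parity $\theta\in\{\mathrm{odd},\mathrm{even}\}$ ($\infty$ if none). $\mathrm{dist}^\alpha(v)$, $\mathrm{dist}^\beta(v)$: min and max of the two; $\alpha(v)$ the parity attaining the min, $\beta(v)$ the other. $\rho(e)=\mathrm{odd}$ if $e\in M^+$, else even. $\mathsf{EP}(u)$: edges $e$ incident to $u$ such that some alternating $f$–$u$ path of length $\mathrm{dist}^\alpha(u)$ ends with $e$; $\mathsf{P}(u)$: their other endpoints. An ABT is a tree $T$ rooted at $f$ on the vertices with $\mathrm{dist}^\alpha<\infty$ with each $u\ne f$ having parent in $\mathsf{P}(u)$; $T(t)$ is the subtree at $t$. An incoming edge of $T(t)$ is a non-tree edge with exactly one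 endpoint in $T(t)$. For $e=\{y,z\}$: $\mathsf{vlevel}(e)=\mathrm{dist}^{\rho(e)}(y)+\mathrm{dist}^{\rho(e)}(z)+1$, $\mathsf{hlevel}(e)=\max\{\mathrm{dist}^{\rho(e)}(y),\mathrm{dist}^{\rho(e)}(z)\}$; the level order is lexicographic in $(\mathsf{vlevel},\mathsf{hlevel})$. $e^*_T(t)$ is a fixed minimum-level incoming edge of $T(t)$. -}

module Defs where

open import Data.Nat using (ℕ; zero; suc; _+_; _≤_; _<_; _≤ᵇ_; _⊔_)
open import Data.Nat.Properties using ()
open import Data.Bool using (Bool; true; false; _∧_; not; if_then_else_)
open import Data.Fin using (Fin; _≟_)
open import Data.Fin.Properties using (any?)
open import Data.Maybe using (Maybe; just; nothing)
open import Data.Product using (Σ; ∃; _×_; _,_)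
open import Data.Sum using (_⊎_)
open import Relation.Nullary using (¬_; does)
open import Relation.Binary.PropositionalEquality using (_≡_; _≢_)
import Data.Bool.Properties as BP

record Graph (n : ℕ) : Set where
  field
    adj    : Fin n → Fin n → Bool
    sym    : ∀ a b → adj a b ≡ adj b a
    irrefl : ∀ a → adj a a ≡ false

record Matching {n : ℕ} (G : Graph n) : Set where
  field
    mat    : Fin n → Fin n → Bool
    sub    : ∀ a b → mat a b ≡ true → Graph.adj G a b ≡ true
    sym    : ∀ a b → mat a b ≡ mat b a
    unique : ∀ a b c → mat a b ≡ true → mat a c ≡ true → b ≡ c

-- Parities and extended naturals (nothing = ∞)

data Parity : Set where
  odd even : Parity

flip : Parity → Parity
flip odd  = even
flip even = odd

parity : ℕ → Parity
parity zero          = even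
parity (suc zero)    = odd
parity (suc (suc k)) = parity k

ℕ∞ : Set
ℕ∞ = Maybe ℕ

_+∞_ : ℕ∞ → ℕ∞ → ℕ∞
just a +∞ just b = just (a + b)
_      +∞ _      = nothing

max∞ : ℕ∞ → ℕ∞ → ℕ∞
max∞ (just a) (just b) = just (a ⊔ b)
max∞ _        _        = nothing

data _<∞_ : ℕ∞ → ℕ∞ → Set where
  fin<fin : ∀ {a b} → a < b → just a <∞ just b
  fin<inf : ∀ {a} → just a <∞ nothing

data _≤∞_ : ℕ∞ → ℕ∞ → Set where
  fin≤fin : ∀ {a b} → a ≤ b → just a ≤∞ just b
  any≤inf : ∀ {a} → a ≤∞ nothing

Level : Set
Level = ℕ∞ × ℕ∞

_<L_ : Level → Level → Set
(v₁ , h₁) <L (v₂ , h₂) = v₁ <∞ v₂ ⊎ (v₁ ≡ v₂ × h₁ <∞ h₂)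

_≤L_ : Level → Level → Set
(v₁ , h₁) ≤L (v₂ , h₂) = v₁ <∞ v₂ ⊎ (v₁ ≡ v₂ × h₁ ≤∞ h₂)

iter : {A : Set} → (A → A) → ℕ → A → A
iter g zero    x = x
iter g (suc k) x = g (iter g k x)

module Plus {n : ℕ} (G : Graph n) (M : Matching G) where
  open Graph G
  open Matching M

  uncovered : Fin n → Bool
  uncovered u = not (does (any? (λ b → mat u b BP.≟ true)))

  -- vertices of G⁺: f, the original vertices, and w u
  -- (w u is only connected when u is uncovered; for covered u it is an
  --  isolated dummy vertex)
  data V⁺ : Set where
    f : V⁺
    v : Fin n → V⁺
    w : Fin n → V⁺

  eqᵇ : Fin n → Fin n → Bool
  eqᵇ a b = does (a ≟ b)

  adj⁺ : V⁺ → V⁺ → Bool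
  adj⁺ (v a) (v b) = adj a b
  adj⁺ f     (w u) = uncovered u
  adj⁺ (w u) f     = uncovered u
  adj⁺ (w u) (v b) = uncovered u ∧ eqᵇ u b
  adj⁺ (v b) (w u) = uncovered u ∧ eqᵇ u b
  adj⁺ _     _     = false

  mat⁺ : V⁺ → V⁺ → Bool
  mat⁺ (v a) (v b) = mat a b
  mat⁺ (w u) (v b) = uncovered u ∧ eqᵇ u b
  mat⁺ (v b) (w u) = uncovered u ∧ eqᵇ u b
  mat⁺ _     _     = false

  ρ : V⁺ → V⁺ → Parity
  ρ a b = if mat⁺ a b then odd else even

  record AltPath (x : V⁺) (k : ℕ) : Set where
    field
      p         : ℕ → V⁺
      start     : p 0 ≡ f
      end       : p k ≡ x
      edges     : ∀ i → i < k → adj⁺ (p i) (p (suc i)) ≡ true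
      alternate : ∀ i → suc i < k →
                  mat⁺ (p i) (p (suc i)) ≢ mat⁺ (p (suc i)) (p (suc (suc i)))
      simple    : ∀ i j → i ≤ k → j ≤ k → p i ≡ p j → i ≡ j

  IsDist : Parity → V⁺ → ℕ∞ → Set
  IsDist θ x (just k) = (AltPath x k × parity k ≡ θ) ×
                        (∀ k' → AltPath x k' → parity k' ≡ θ → k ≤ k')
  IsDist θ x nothing  = ∀ k → AltPath x k → parity k ≢ θ

  module WithDist (dist : Parity → V⁺ → ℕ∞) where

    -- α(x): the parity attaining the minimum (ties only when both are ∞)
    α : V⁺ → Parity
    α x with dist odd x | dist even x
    ... | just a  | just b  = if a ≤ᵇ b then odd else even
    ... | just _  | nothing = odd
    ... | nothing | just _  = even
    ... | nothing | nothing = odd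

    β : V⁺ → Parity
    β x = flip (α x)

    EP : V⁺ → V⁺ → Set
    EP x y = Σ ℕ λ m → dist (α x) x ≡ just (suc m) ×
             Σ (AltPath x (suc m)) λ P → AltPath.p P m ≡ y

    InT : V⁺ → Set
    InT x = ∃ λ k → dist (α x) x ≡ just k

    IsABT : (V⁺ → V⁺) → Set
    IsABT par = (∀ u → InT u → u ≢ f → EP u (par u)) ×
                (∀ u → InT u → ∃ λ k → iter par k u ≡ f)

    module Tree (par : V⁺ → V⁺) where

      TreeEdge : V⁺ → V⁺ → Set
      TreeEdge a b = (InT a × a ≢ f × par a ≡ b) ⊎ (InT b × b ≢ f × par b ≡ a)

      InSub : V⁺ → V⁺ → Set
      InSub t u = InT u × Σ ℕ λ k → iter par k u ≡ t ×
                  (∀ j → j < k → iter par j u ≢ f)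

      Incoming : V⁺ → V⁺ → V⁺ → Set
      Incoming t a b = adj⁺ a b ≡ true × ¬ TreeEdge a b ×
                       ((InSub t a × ¬ InSub t b) ⊎ (¬ InSub t a × InSub t b))

      vlevel : V⁺ → V⁺ → ℕ∞
      vlevel a b = (dist (ρ a b) a +∞ dist (ρ a b) b) +∞ just 1

      hlevel : V⁺ → V⁺ → ℕ∞
      hlevel a b = max∞ (dist (ρ a b) a) (dist (ρ a b) b)

      level : V⁺ → V⁺ → Level
      level a b = vlevel a b , hlevel a b

      MinIncoming : V⁺ → V⁺ → V⁺ → Set
      MinIncoming t a b = Incoming t a b ×
                          (∀ a' b' → Incoming t a' b' → level a b ≤L level a' b')

{-# OPTIONS --safe #-}
module Submission where

-- Let A = dist^α(t) < B = dist^β(t), and let R and P be alternating paths to t of lengths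
-- A and B. The last edge {p m, p (m+1)} along which P enters T(t) is incoming to T(t).
-- Its endpoint p m is reached by a prefix of P (length m), and p (m+1) by R followed by P
-- walked backwards (length A + B - m - 1, of the same parity as m); these two parts share
-- only t, because dist^α is at least A on T(t) but below A on R before t. Hence e*_T(t)
-- has level below (A + B, B). Conversely, for an edge {y, t} with ρ = β(t), a shortest
-- alternating path to y of parity β(t), of length q, either passes through t after at
-- least A steps, or extends by the edge to an alternating path to t, so q + 1 ≥ A, with
-- equality only if the edge is in EP(t); this gives level at least (A + B, B). Edges in
-- EP(t) have ρ = β(t), so ρ = α(t) happens only in the excluded case.

open import Defs
open import Data.Nat using (ℕ)
open import Data.Bool using (true)
open import Data.Maybe using (just)
open import Data.Product using (∃; _×_)
open import Relation.Nullary using (¬_)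
open import Relation.Binary.PropositionalEquality using (_≡_)

open import Data.Nat using (zero; suc; _+_; _∸_; _≤_; _<_; _≤ᵇ_; _⊔_; z≤n; s≤s; z<s; s≤s⁻¹)
open import Data.Nat.Properties
open import Data.Nat.Solver using (module +-*-Solver)
open import Data.Bool using (false; T; if_then_else_)
import Data.Fin as Fin
open import Data.Maybe using (nothing)
open import Data.Maybe.Properties using (just-injective)
open import Data.Product using (Σ; ∃₂; _,_; proj₁; proj₂)
open import Data.Sum using (_⊎_; inj₁; inj₂)
open import Data.Empty using (⊥-elim)
open import Function using (_∘_)
open import Relation.Nullary using (Dec; yes; no; contradiction)
open import Relation.Nullary.Decidable using (map′)
open import Relation.Binary.Definitions using (DecidableEquality)
open import Relation.Binary.PropositionalEquality using (_≢_; refl; sym; trans; cong; cong₂; subst; module ≡-Reasoning)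

-- Parity arithmetic

flip-involutive : ∀ θ → flip (flip θ) ≡ θ
flip-involutive odd  = refl
flip-involutive even = refl

flip≢ : ∀ θ → flip θ ≢ θ
flip≢ odd  ()
flip≢ even ()

parity-dichotomy : ∀ θ φ → θ ≡ φ ⊎ θ ≡ flip φ
parity-dichotomy odd  odd  = inj₁ refl
parity-dichotomy odd  even = inj₂ refl
parity-dichotomy even odd  = inj₂ refl
parity-dichotomy even even = inj₁ refl

parity-suc : ∀ k → parity (suc k) ≡ flip (parity k)
parity-suc zero    = refl
parity-suc (suc k) = sym (trans (cong flip (parity-suc k)) (flip-involutive (parity k)))

infixl 6 _⊕_
_⊕_ : Parity → Parity → Parity
even ⊕ φ = φ
odd  ⊕ φ = flip φ

flip-⊕ : ∀ θ φ → flip (θ ⊕ φ) ≡ flip θ ⊕ φ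
flip-⊕ odd  φ = flip-involutive φ
flip-⊕ even φ = refl

parity-+ : ∀ m n → parity (m + n) ≡ parity m ⊕ parity n
parity-+ zero    n = refl
parity-+ (suc m) n = begin
  parity (suc (m + n))        ≡⟨ parity-suc (m + n) ⟩
  flip (parity (m + n))       ≡⟨ cong flip (parity-+ m n) ⟩
  flip (parity m ⊕ parity n)  ≡⟨ flip-⊕ (parity m) (parity n) ⟩
  flip (parity m) ⊕ parity n  ≡⟨ cong (_⊕ parity n) (sym (parity-suc m)) ⟩
  parity (suc m) ⊕ parity n   ∎
  where open ≡-Reasoning

⊕-transpose : ∀ θ φ ψ → θ ⊕ flip φ ≡ flip ψ → θ ⊕ ψ ≡ φ
⊕-transpose even odd  odd  _  = refl
⊕-transpose even even even _  = refl
⊕-transpose odd  odd  even _  = refl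
⊕-transpose odd  even odd  _  = refl
⊕-transpose even odd  even ()
⊕-transpose even even odd  ()
⊕-transpose odd  odd  odd  ()
⊕-transpose odd  even even ()

parity-complement : ∀ {A B} s j → parity B ≡ flip (parity A) → s + suc j ≡ B →
                    parity (s + A) ≡ parity j
parity-complement {A} {B} s j parity-B s+j+1≡B = begin
  parity (s + A)       ≡⟨ parity-+ s A ⟩
  parity s ⊕ parity A  ≡⟨ ⊕-transpose (parity s) (parity j) (parity A) parity-s+j+1 ⟩
  parity j             ∎
  where
  open ≡-Reasoning
  parity-s+j+1 : parity s ⊕ flip (parity j) ≡ flip (parity A)
  parity-s+j+1 = begin
    parity s ⊕ flip (parity j)  ≡⟨ cong (parity s ⊕_) (sym (parity-suc j)) ⟩
    parity s ⊕ parity (suc j)   ≡⟨ sym (parity-+ s (suc j)) ⟩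
    parity (s + suc j)          ≡⟨ cong parity s+j+1≡B ⟩
    parity B                    ≡⟨ parity-B ⟩
    flip (parity A)             ∎

-- Extended naturals and levels

<∞-trans : ∀ {a b c} → a <∞ b → b <∞ c → a <∞ c
<∞-trans (fin<fin a<b) (fin<fin b<c) = fin<fin (<-trans a<b b<c)
<∞-trans (fin<fin _)   fin<inf       = fin<inf

≤∞-<∞-trans : ∀ {a b c} → a ≤∞ b → b <∞ c → a <∞ c
≤∞-<∞-trans (fin≤fin a≤b) (fin<fin b<c) = fin<fin (≤-<-trans a≤b b<c)
≤∞-<∞-trans (fin≤fin _)   fin<inf       = fin<inf

<∞-≤∞-trans : ∀ {a b c} → a <∞ b → b ≤∞ c → a <∞ c
<∞-≤∞-trans (fin<fin a<b) (fin≤fin b≤c) = fin<fin (<-≤-trans a<b b≤c)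
<∞-≤∞-trans (fin<fin _)   any≤inf       = fin<inf
<∞-≤∞-trans fin<inf       any≤inf       = fin<inf

<∞⇒≤∞ : ∀ {a b} → a <∞ b → a ≤∞ b
<∞⇒≤∞ (fin<fin a<b) = fin≤fin (<⇒≤ a<b)
<∞⇒≤∞ fin<inf       = any≤inf

≤∞-refl : ∀ {a} → a ≤∞ a
≤∞-refl {just a}  = fin≤fin ≤-refl
≤∞-refl {nothing} = any≤inf

≤L-<L-trans : ∀ {v₁ h₁ v₂ h₂ v₃ h₃} →
              (v₁ , h₁) ≤L (v₂ , h₂) → (v₂ , h₂) <L (v₃ , h₃) → (v₁ , h₁) <L (v₃ , h₃)
≤L-<L-trans (inj₁ v₁<v₂)         (inj₁ v₂<v₃)         = inj₁ (<∞-trans v₁<v₂ v₂<v₃)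
≤L-<L-trans (inj₁ v₁<v₂)         (inj₂ (refl , _))     = inj₁ v₁<v₂
≤L-<L-trans (inj₂ (refl , _))     (inj₁ v₂<v₃)         = inj₁ v₂<v₃
≤L-<L-trans (inj₂ (refl , h₁≤h₂)) (inj₂ (refl , h₂<h₃)) = inj₂ (refl , ≤∞-<∞-trans h₁≤h₂ h₂<h₃)

<L-≤L-trans : ∀ {v₁ h₁ v₂ h₂ v₃ h₃} →
              (v₁ , h₁) <L (v₂ , h₂) → (v₂ , h₂) ≤L (v₃ , h₃) → (v₁ , h₁) <L (v₃ , h₃)
<L-≤L-trans (inj₁ v₁<v₂)         (inj₁ v₂<v₃)         = inj₁ (<∞-trans v₁<v₂ v₂<v₃)
<L-≤L-trans (inj₁ v₁<v₂)         (inj₂ (refl , _))     = inj₁ v₁<v₂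
<L-≤L-trans (inj₂ (refl , _))     (inj₁ v₂<v₃)         = inj₁ v₂<v₃
<L-≤L-trans (inj₂ (refl , h₁<h₂)) (inj₂ (refl , h₂≤h₃)) = inj₂ (refl , <∞-≤∞-trans h₁<h₂ h₂≤h₃)

<L⇒vlevel-≤∞ : ∀ {v₁ h₁ v₂ h₂} → (v₁ , h₁) <L (v₂ , h₂) → v₁ ≤∞ v₂
<L⇒vlevel-≤∞ (inj₁ v₁<v₂)     = <∞⇒≤∞ v₁<v₂
<L⇒vlevel-≤∞ (inj₂ (refl , _)) = ≤∞-refl

≤-<⇒<L : ∀ {v h v′ h′} → v ≤ v′ → h < h′ → (just v , just h) <L (just v′ , just h′)
≤-<⇒<L v≤v′ h<h′ with m≤n⇒m<n∨m≡n v≤v′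
... | inj₁ v<v′ = inj₁ (fin<fin v<v′)
... | inj₂ refl = inj₂ (refl , fin<fin h<h′)

-- Searching along ℕ and along iterates of a function

last-crossing : ∀ {S : ℕ → Set} → (∀ j → Dec (S j)) → ∀ N → ¬ S 0 → S N →
                ∃ λ m → m < N × ¬ S m × (∀ j → m < j → j ≤ N → S j)
last-crossing S? zero    ¬S0 SN  = ⊥-elim (¬S0 SN)
last-crossing {S} S? (suc N) ¬S0 S1+N with S? N
... | no ¬SN = N , ≤-refl , ¬SN , λ j N<j j≤1+N → subst S (≤-antisym N<j j≤1+N) S1+N
... | yes SN with last-crossing S? N ¬S0 SN
...   | m , m<N , ¬Sm , after = m , m<n⇒m<1+n m<N , ¬Sm , after′
  where
  after′ : ∀ j → m < j → j ≤ suc N → S j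
  after′ j m<j j≤1+N with m≤n⇒m<n∨m≡n j≤1+N
  ... | inj₁ j<1+N = after j m<j (s≤s⁻¹ j<1+N)
  ... | inj₂ refl  = S1+N

iter-suc : ∀ {A : Set} (g : A → A) k x → iter g (suc k) x ≡ iter g k (g x)
iter-suc g zero    x = refl
iter-suc g (suc k) x = cong g (iter-suc g k x)

-- Tree.InSub t u unfolds to InT u × Reaches par f t u.
module Reachability {A : Set} (g : A → A) (root : A) where

  Reaches : A → A → Set
  Reaches t u = ∃ λ k → iter g k u ≡ t × (∀ j → j < k → iter g j u ≢ root)

  avoids-tail : ∀ {u k} → (∀ j → j < suc k → iter g j u ≢ root) →
                ∀ j → j < k → iter g j (g u) ≢ root
  avoids-tail {u} avoid j j<k = avoid (suc j) (s≤s j<k) ∘ trans (iter-suc g j u)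

  reaches-step : ∀ {t u} → u ≢ root → Reaches t (g u) → Reaches t u
  reaches-step {u = u} u≢root (k , e , avoid) = suc k , trans (iter-suc g k u) e , avoid′
    where
    avoid′ : ∀ j → j < suc k → iter g j u ≢ root
    avoid′ zero    _       = u≢root
    avoid′ (suc j) 1+j<1+k = avoid j (s≤s⁻¹ 1+j<1+k) ∘ trans (sym (iter-suc g j u))

  reaches-unstep : ∀ {t u} → u ≢ t → Reaches t u → Reaches t (g u)
  reaches-unstep u≢t (zero  , e , _)     = ⊥-elim (u≢t e)
  reaches-unstep {u = u} _ (suc k , e , avoid) = k , trans (sym (iter-suc g k u)) e , avoids-tail avoid

  reaches⇒≢root : ∀ {t u} → Reaches t u → u ≢ t → u ≢ root
  reaches⇒≢root (zero  , e , _)     u≢t = ⊥-elim (u≢t e)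
  reaches⇒≢root (suc k , _ , avoid) _   = avoid 0 z<s

  reaches-from-root : ∀ {t} → Reaches t root → root ≡ t
  reaches-from-root (zero  , e , _)     = e
  reaches-from-root (suc k , _ , avoid) = ⊥-elim (avoid 0 z<s refl)

  reaches? : DecidableEquality A → ∀ t N u → iter g N u ≡ root → Dec (Reaches t u)
  reaches? _≟_ t N u gᴺu≡root with u ≟ t | u ≟ root
  ... | yes u≡t | _          = yes (0 , u≡t , λ _ ())
  ... | no u≢t  | yes u≡root = no (u≢t ∘ trans u≡root ∘ reaches-from-root ∘ subst (Reaches t) u≡root)
  reaches? _≟_ t zero    u gᴺu≡root | no _   | no u≢root = ⊥-elim (u≢root gᴺu≡root)
  reaches? _≟_ t (suc N) u gᴺu≡root | no u≢t | no u≢root =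
    map′ (reaches-step u≢root) (reaches-unstep u≢t)
         (reaches? _≟_ t N (g u) (trans (sym (iter-suc g N u)) gᴺu≡root))

open Reachability using (Reaches)

-- Alternating paths and ABTs in G⁺

module AugmentedGraph {n : ℕ} (G : Graph n) (M : Matching G) where
  open Plus G M

  _≟V_ : DecidableEquality V⁺
  f   ≟V f   = yes refl
  v a ≟V v b = map′ (cong v) (λ { refl → refl }) (a Fin.≟ b)
  w a ≟V w b = map′ (cong w) (λ { refl → refl }) (a Fin.≟ b)
  f   ≟V v _ = no λ ()
  f   ≟V w _ = no λ ()
  v _ ≟V f   = no λ ()
  v _ ≟V w _ = no λ ()
  w _ ≟V f   = no λ ()
  w _ ≟V v _ = no λ ()

  adj⁺-sym : ∀ a b → adj⁺ a b ≡ adj⁺ b a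
  adj⁺-sym f     f     = refl
  adj⁺-sym f     (v _) = refl
  adj⁺-sym f     (w _) = refl
  adj⁺-sym (v _) f     = refl
  adj⁺-sym (v a) (v b) = Graph.sym G a b
  adj⁺-sym (v _) (w _) = refl
  adj⁺-sym (w _) f     = refl
  adj⁺-sym (w _) (v _) = refl
  adj⁺-sym (w _) (w _) = refl

  mat⁺-sym : ∀ a b → mat⁺ a b ≡ mat⁺ b a
  mat⁺-sym f     f     = refl
  mat⁺-sym f     (v _) = refl
  mat⁺-sym f     (w _) = refl
  mat⁺-sym (v _) f     = refl
  mat⁺-sym (v a) (v b) = Matching.sym M a b
  mat⁺-sym (v _) (w _) = refl
  mat⁺-sym (w _) f     = refl
  mat⁺-sym (w _) (v _) = refl
  mat⁺-sym (w _) (w _) = refl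

  adj⁺-irrefl : ∀ a → adj⁺ a a ≡ false
  adj⁺-irrefl f     = refl
  adj⁺-irrefl (v a) = Graph.irrefl G a
  adj⁺-irrefl (w _) = refl

  adj⁺⇒≢ : ∀ {a b} → adj⁺ a b ≡ true → a ≢ b
  adj⁺⇒≢ {a} adj refl = contradiction (trans (sym adj) (adj⁺-irrefl a)) λ ()

  ρ-sym : ∀ a b → ρ a b ≡ ρ b a
  ρ-sym a b = cong (λ m → if m then odd else even) (mat⁺-sym a b)

  ρ-alternates : ∀ a b c d → mat⁺ a b ≢ mat⁺ c d → ρ c d ≡ flip (ρ a b)
  ρ-alternates a b c d ≢ with mat⁺ a b | mat⁺ c d
  ... | false | false = ⊥-elim (≢ refl)
  ... | false | true  = refl
  ... | true  | false = refl
  ... | true  | true  = ⊥-elim (≢ refl)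

  ρ-step : ∀ {x k} (P : AltPath x k) j → j < k →
           ρ (AltPath.p P j) (AltPath.p P (suc j)) ≡ parity j
  ρ-step P zero _ rewrite AltPath.start P = refl
  ρ-step P (suc j) 1+j<k = begin
    ρ (p (suc j)) (p (suc (suc j)))  ≡⟨ ρ-alternates (p j) (p (suc j)) (p (suc j)) (p (suc (suc j))) (alternate j 1+j<k) ⟩
    flip (ρ (p j) (p (suc j)))       ≡⟨ cong flip (ρ-step P j (<⇒≤ 1+j<k)) ⟩
    flip (parity j)                  ≡⟨ sym (parity-suc j) ⟩
    parity (suc j)                   ∎
    where
    open ≡-Reasoning
    open AltPath P

  alternating-walk : ∀ {x k} (q : ℕ → V⁺) → q 0 ≡ f → q k ≡ x →
                     (∀ j → j < k → adj⁺ (q j) (q (suc j)) ≡ true) →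
                     (∀ j → j < k → ρ (q j) (q (suc j)) ≡ parity j) →
                     (∀ i j → i ≤ k → j ≤ k → q i ≡ q j → i ≡ j) → AltPath x k
  alternating-walk q q0≡f qk≡x edges ρ-q simple = record
    { p = q ; start = q0≡f ; end = qk≡x ; edges = edges ; alternate = alternate ; simple = simple }
    where
    alternate : ∀ j → suc j < _ → mat⁺ (q j) (q (suc j)) ≢ mat⁺ (q (suc j)) (q (suc (suc j)))
    alternate j 1+j<k same = flip≢ (parity j) (begin
      flip (parity j)                  ≡⟨ sym (parity-suc j) ⟩
      parity (suc j)                   ≡⟨ sym (ρ-q (suc j) 1+j<k) ⟩
      ρ (q (suc j)) (q (suc (suc j)))  ≡⟨ cong (λ m → if m then odd else even) (sym same) ⟩
      ρ (q j) (q (suc j))              ≡⟨ ρ-q j (<⇒≤ 1+j<k) ⟩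
      parity j                         ∎)
      where open ≡-Reasoning

  prefix : ∀ {x k} (P : AltPath x k) i → i ≤ k → AltPath (AltPath.p P i) i
  prefix P i i≤k = record
    { p         = p
    ; start     = start
    ; end       = refl
    ; edges     = λ j j<i → edges j (<-≤-trans j<i i≤k)
    ; alternate = λ j j<i → alternate j (<-≤-trans j<i i≤k)
    ; simple    = λ a b a≤i b≤i → simple a b (≤-trans a≤i i≤k) (≤-trans b≤i i≤k)
    }
    where open AltPath P

  retarget : ∀ {x y k} → x ≡ y → AltPath x k → AltPath y k
  retarget x≡y P = record
    { p = p ; start = start ; end = trans end x≡y ; edges = edges ; alternate = alternate ; simple = simple }
    where open AltPath P

  length-to-f : ∀ {x k} → AltPath x k → x ≡ f → k ≡ 0
  length-to-f {k = k} P x≡f = sym (simple 0 k z≤n ≤-refl (trans start (sym (trans end x≡f))))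
    where open AltPath P

  infix 4 _∈ₚ_ _∈ₚ?_
  _∈ₚ_ : ∀ {x k} → V⁺ → AltPath x k → Set
  _∈ₚ_ {k = k} u P = ∃ λ i → i ≤ k × AltPath.p P i ≡ u

  _∈ₚ?_ : ∀ {x k} u (P : AltPath x k) → Dec (u ∈ₚ P)
  _∈ₚ?_ {k = k} u P =
    map′ (λ (i , i<1+k , e) → i , s≤s⁻¹ i<1+k , e) (λ (i , i≤k , e) → i , s≤s i≤k , e)
         (anyUpTo? (λ i → AltPath.p P i ≟V u) (suc k))

  module Snoc {x k} (P : AltPath x k) where
    open AltPath P

    extend : V⁺ → ℕ → V⁺
    extend y j with j ≤? k
    ... | yes _ = p j
    ... | no  _ = y

    extend-≤ : ∀ {y j} → j ≤ k → extend y j ≡ p j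
    extend-≤ {j = j} j≤k with j ≤? k
    ... | yes _   = refl
    ... | no  j≰k = contradiction j≤k j≰k

    extend-cases : ∀ {y i} → i ≤ suc k → (i ≤ k × extend y i ≡ p i) ⊎ (i ≡ suc k × extend y i ≡ y)
    extend-cases {i = i} i≤1+k with i ≤? k
    ... | yes i≤k = inj₁ (i≤k , refl)
    ... | no  i≰k with m≤n⇒m<n∨m≡n i≤1+k
    ...   | inj₁ i<1+k = contradiction (s≤s⁻¹ i<1+k) i≰k
    ...   | inj₂ i≡1+k = inj₂ (i≡1+k , refl)

    snoc : ∀ {y} → adj⁺ x y ≡ true → ρ x y ≡ parity k → ¬ y ∈ₚ P → AltPath y (suc k)
    snoc {y} adj ρ-xy y∉P =
      alternating-walk (extend y) (trans (extend-≤ {y} z≤n) start) last-y edges′ ρ-edges simple′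
      where
      last-y : extend y (suc k) ≡ y
      last-y with extend-cases {y} (≤-refl {suc k})
      ... | inj₁ (1+k≤k , _) = contradiction 1+k≤k 1+n≰n
      ... | inj₂ (_ , e)     = e

      edge-cases : ∀ (Edge : ℕ → V⁺ → V⁺ → Set) → (∀ j → j < k → Edge j (p j) (p (suc j))) →
                   Edge k x y → ∀ j → j < suc k → Edge j (extend y j) (extend y (suc j))
      edge-cases Edge old new j j<1+k with m≤n⇒m<n∨m≡n (s≤s⁻¹ j<1+k)
      ... | inj₁ j<k rewrite extend-≤ {y} (<⇒≤ j<k) | extend-≤ {y} j<k = old j j<k
      ... | inj₂ refl rewrite extend-≤ {y} (≤-refl {k}) | last-y | end = new

      edges′ : ∀ j → j < suc k → adj⁺ (extend y j) (extend y (suc j)) ≡ true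
      edges′ = edge-cases (λ _ a b → adj⁺ a b ≡ true) edges adj

      ρ-edges : ∀ j → j < suc k → ρ (extend y j) (extend y (suc j)) ≡ parity j
      ρ-edges = edge-cases (λ j a b → ρ a b ≡ parity j) (ρ-step P) ρ-xy

      simple′ : ∀ i j → i ≤ suc k → j ≤ suc k → extend y i ≡ extend y j → i ≡ j
      simple′ i j i≤ j≤ e with extend-cases i≤ | extend-cases j≤
      ... | inj₁ (i≤k , eᵢ) | inj₁ (j≤k , eⱼ) = simple i j i≤k j≤k (trans (sym eᵢ) (trans e eⱼ))
      ... | inj₁ (i≤k , eᵢ) | inj₂ (_ , eⱼ)   = ⊥-elim (y∉P (i , i≤k , trans (sym eᵢ) (trans e eⱼ)))
      ... | inj₂ (_ , eᵢ)   | inj₁ (j≤k , eⱼ) = ⊥-elim (y∉P (j , j≤k , trans (sym eⱼ) (trans (sym e) eᵢ)))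
      ... | inj₂ (i≡ , _)   | inj₂ (j≡ , _)   = trans i≡ (sym j≡)

    ∈ₚ-snoc : ∀ {y u} adj ρ-xy y∉P → u ∈ₚ snoc {y} adj ρ-xy y∉P → u ∈ₚ P ⊎ u ≡ y
    ∈ₚ-snoc _ _ _ (i , i≤1+k , e) with extend-cases i≤1+k
    ... | inj₁ (i≤k , eᵢ) = inj₁ (i , i≤k , trans (sym eᵢ) e)
    ... | inj₂ (_ , eᵢ)   = inj₂ (trans (sym e) eᵢ)

  open Snoc

  module Distances (dist : Parity → V⁺ → ℕ∞) (isDist : ∀ θ x → IsDist θ x (dist θ x)) where
    open WithDist dist

    shortest-path : ∀ {θ x d} → dist θ x ≡ just d → AltPath x d × parity d ≡ θ
    shortest-path {θ} {x} e = proj₁ (subst (IsDist θ x) e (isDist θ x))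

    dist≤length : ∀ {x k} → AltPath x k → ∃ λ d → dist (parity k) x ≡ just d × d ≤ k
    dist≤length {x} {k} P with dist (parity k) x | isDist (parity k) x
    ... | just d  | (_ , minimal) = d , refl , minimal k P refl
    ... | nothing | none          = ⊥-elim (none k P refl)

    distα-minimal : ∀ θ x {d} → dist θ x ≡ just d → ∃ λ a → dist (α x) x ≡ just a × a ≤ d
    distα-minimal odd x e with dist odd x in eo | dist even x in ee
    distα-minimal odd x refl | just a | just b with a ≤ᵇ b in a≤ᵇb
    ... | true  = a , eo , ≤-refl
    ... | false = b , ee , <⇒≤ (≰⇒> (subst T a≤ᵇb ∘ ≤⇒≤ᵇ))
    distα-minimal odd x refl | just a | nothing = a , eo , ≤-refl
    distα-minimal even x e with dist odd x in eo | dist even x in ee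
    distα-minimal even x refl | just a | just b with a ≤ᵇ b in a≤ᵇb
    ... | true  = a , eo , ≤ᵇ⇒≤ a b (subst T (sym a≤ᵇb) _)
    ... | false = b , ee , ≤-refl
    distα-minimal even x refl | nothing | just b = b , ee , ≤-refl

    distα≤length : ∀ {x k} → AltPath x k → ∃ λ a → dist (α x) x ≡ just a × a ≤ k
    distα≤length P with dist≤length P
    ... | d , e , d≤k with distα-minimal _ _ e
    ...   | a , eα , a≤d = a , eα , ≤-trans a≤d d≤k

    EP⇒ρ≡β : ∀ {x y} → EP x y → ρ y x ≡ β x
    EP⇒ρ≡β {x} {y} (m , e , P , pm≡y) = begin
      ρ y x                        ≡⟨ cong₂ ρ (sym pm≡y) (sym end) ⟩
      ρ (p m) (p (suc m))          ≡⟨ ρ-step P m ≤-refl ⟩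
      parity m                     ≡⟨ sym (flip-involutive (parity m)) ⟩
      flip (flip (parity m))       ≡⟨ cong flip (sym (parity-suc m)) ⟩
      flip (parity (suc m))        ≡⟨ cong flip (proj₂ (shortest-path e)) ⟩
      β x                          ∎
      where
      open ≡-Reasoning
      open AltPath P

    ρ≡β-unless-α-edge : ∀ {t y} → ¬ (¬ EP t y × ρ y t ≡ α t) → ρ y t ≡ β t
    ρ≡β-unless-α-edge {t} {y} h with parity-dichotomy (ρ y t) (α t)
    ... | inj₂ ρ≡β = ρ≡β
    ... | inj₁ ρ≡α = ⊥-elim (h ((λ ep → flip≢ (α t) (trans (sym (EP⇒ρ≡β ep)) ρ≡α)) , ρ≡α))

    module Subtrees (par : V⁺ → V⁺) (abt : IsABT par) where
      open Tree par
      open Reachability par f using (avoids-tail; reaches-step; reaches-unstep; reaches⇒≢root; reaches-from-root; reaches?)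

      parent-closer : ∀ {u a} → dist (α u) u ≡ just a → u ≢ f →
                      ∃ λ b → dist (α (par u)) (par u) ≡ just b × b < a
      parent-closer {u} {a} e u≢f with proj₁ abt u (a , e) u≢f
      ... | m , e′ , P , pm≡par with distα≤length (prefix P m (n≤1+n m))
      ...   | b , eb , b≤m = b , subst (λ z → dist (α z) z ≡ just b) pm≡par eb ,
                             <-≤-trans (s≤s b≤m) (≤-reflexive (just-injective (trans (sym e′) e)))

      InT-parent : ∀ {u} → InT u → u ≢ f → InT (par u)
      InT-parent (a , e) u≢f with parent-closer e u≢f
      ... | b , eb , _ = b , eb

      InSub-parent : ∀ {t u} → InSub t u → u ≢ t → InSub t (par u)
      InSub-parent (u∈T , r) u≢t = InT-parent u∈T (reaches⇒≢root r u≢t) , reaches-unstep u≢t r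

      InSub-child : ∀ {t u} → InT u → u ≢ f → InSub t (par u) → InSub t u
      InSub-child u∈T u≢f (_ , r) = u∈T , reaches-step u≢f r

      InT? : ∀ u → Dec (InT u)
      InT? u with dist (α u) u
      ... | just a  = yes (a , refl)
      ... | nothing = no λ { (_ , ()) }

      InSub? : ∀ t u → Dec (InSub t u)
      InSub? t u with InT? u
      ... | no u∉T  = no (u∉T ∘ proj₁)
      ... | yes u∈T with proj₂ abt u u∈T
      ...   | N , parᴺu≡f = map′ (u∈T ,_) proj₂ (reaches? _≟V_ t N u parᴺu≡f)

      distα-along : ∀ {t u a b} k → iter par k u ≡ t → (∀ j → j < k → iter par j u ≢ f) →
                    dist (α t) t ≡ just a → dist (α u) u ≡ just b → k + a ≤ b
      distα-along zero refl _ ea eb = ≤-reflexive (just-injective (trans (sym ea) eb))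
      distα-along {u = u} (suc k) e avoid ea eb with parent-closer eb (avoid 0 z<s)
      ... | b′ , eb′ , b′<b =
        ≤-trans (s≤s (distα-along k (trans (sym (iter-suc par k u)) e) (avoids-tail avoid) ea eb′)) b′<b

      InSub⇒distα≥ : ∀ {t u a b} → InSub t u → dist (α t) t ≡ just a → dist (α u) u ≡ just b → a ≤ b
      InSub⇒distα≥ (_ , k , e , avoid) ea eb = ≤-trans (m≤n+m _ k) (distα-along k e avoid ea eb)

      InSub⇒distα> : ∀ {t u a b} → InSub t u → u ≢ t →
                     dist (α t) t ≡ just a → dist (α u) u ≡ just b → a < b
      InSub⇒distα> (_ , zero  , e , _)     u≢t _  _  = ⊥-elim (u≢t e)
      InSub⇒distα> (_ , suc k , e , avoid) _   ea eb =
        ≤-trans (s≤s (m≤n+m _ k)) (distα-along (suc k) e avoid ea eb)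

      level-finite : ∀ {a b θ d₁ d₂} → ρ a b ≡ θ → dist θ a ≡ just d₁ → dist θ b ≡ just d₂ →
                     level a b ≡ (just (d₁ + d₂ + 1) , just (d₁ ⊔ d₂))
      level-finite refl e₁ e₂ = cong₂ (λ x y → ((x +∞ y) +∞ just 1 , max∞ x y)) e₁ e₂

      level-infinite : ∀ {a b θ} → ρ a b ≡ θ → dist θ a ≡ nothing → level a b ≡ (nothing , nothing)
      level-infinite {b = b} {θ} refl e = cong (λ x → ((x +∞ dist θ b) +∞ just 1 , max∞ x (dist θ b))) e

      module AroundVertex {t A B} (eA : dist (α t) t ≡ just A) (eB : dist (β t) t ≡ just B) where

        R : AltPath t A
        R = proj₁ (shortest-path eA)

        P : AltPath t B
        P = proj₁ (shortest-path eB)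

        open AltPath P

        parity-B : parity B ≡ β t
        parity-B = proj₂ (shortest-path eB)

        parity-B≡flip-A : parity B ≡ flip (parity A)
        parity-B≡flip-A = trans parity-B (cong flip (sym (proj₂ (shortest-path eA))))

        A≤length : ∀ {k} → AltPath t k → A ≤ k
        A≤length Q with distα≤length Q
        ... | a , ea , a≤k = subst (_≤ _) (just-injective (trans (sym ea) eA)) a≤k

        A<B : A < B
        A<B = ≤∧≢⇒< (A≤length P) λ A≡B →
                flip≢ (parity A) (trans (sym parity-B≡flip-A) (cong parity (sym A≡B)))

        t≢f : t ≢ f
        t≢f t≡f = n≮0 (subst (A <_) (length-to-f P t≡f) A<B)

        -- The last vertex of P outside T(t) starts an incoming edge of T(t).
        crossing : ∃ λ m → m < B × ¬ InSub t (p m) × (∀ j → m < j → j ≤ B → InSub t (p j))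
        crossing = last-crossing (λ j → InSub? t (p j)) B p0∉ pB∈
          where
          p0∉ : ¬ InSub t (p 0)
          p0∉ (_ , r) = t≢f (sym (reaches-from-root (subst (Reaches par f t) start r)))
          pB∈ : InSub t (p B)
          pB∈ = subst (InSub t) (sym end) ((A , eA) , 0 , refl , λ _ ())

        m : ℕ
        m = proj₁ crossing

        m<B : m < B
        m<B = proj₁ (proj₂ crossing)

        pm∉ : ¬ InSub t (p m)
        pm∉ = proj₁ (proj₂ (proj₂ crossing))

        later∈ : ∀ j → m < j → j ≤ B → InSub t (p j)
        later∈ = proj₂ (proj₂ (proj₂ crossing))

        pm+1∈ : InSub t (p (suc m))
        pm+1∈ = later∈ (suc m) ≤-refl m<B

        pm+1≡t⇒m+1≡B : p (suc m) ≡ t → suc m ≡ B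
        pm+1≡t⇒m+1≡B e = simple (suc m) B m<B ≤-refl (trans e (sym end))

        ρ-crossing : ρ (p m) (p (suc m)) ≡ parity m
        ρ-crossing = ρ-step P m m<B

        crossing-not-tree : ¬ TreeEdge (p m) (p (suc m))
        crossing-not-tree (inj₁ (pm∈T , pm≢f , par-pm≡)) =
          pm∉ (InSub-child pm∈T pm≢f (subst (InSub t) (sym par-pm≡) pm+1∈))
        crossing-not-tree (inj₂ (pm+1∈T , pm+1≢f , par-pm+1≡)) with p (suc m) ≟V t
        ... | no pm+1≢t = pm∉ (subst (InSub t) par-pm+1≡ (InSub-parent pm+1∈ pm+1≢t))
        ... | yes pm+1≡t = flip≢ (parity m) (begin
          flip (parity m)                  ≡⟨ sym (parity-suc m) ⟩
          parity (suc m)                   ≡⟨ cong parity (pm+1≡t⇒m+1≡B pm+1≡t) ⟩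
          parity B                         ≡⟨ parity-B ⟩
          β t                              ≡⟨ cong β (sym pm+1≡t) ⟩
          β (p (suc m))                    ≡⟨ sym (EP⇒ρ≡β (proj₁ abt _ pm+1∈T pm+1≢f)) ⟩
          ρ (par (p (suc m))) (p (suc m))  ≡⟨ cong (λ z → ρ z (p (suc m))) par-pm+1≡ ⟩
          ρ (p m) (p (suc m))              ≡⟨ ρ-crossing ⟩
          parity m                         ∎)
          where open ≡-Reasoning

        A≤m : A ≤ m
        A≤m with p (suc m) ≟V t
        ... | yes pm+1≡t = s≤s⁻¹ (subst (A <_) (sym (pm+1≡t⇒m+1≡B pm+1≡t)) A<B)
        ... | no pm+1≢t with distα≤length (prefix P (suc m) m<B)
        ...   | d , ed , d≤m+1 = s≤s⁻¹ (<-≤-trans (InSub⇒distα> pm+1∈ pm+1≢t eA ed) d≤m+1)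

        R-outside : ∀ i → i < A → ¬ InSub t (AltPath.p R i)
        R-outside i i<A Ri∈ with distα≤length (prefix R i (<⇒≤ i<A))
        ... | d , ed , d≤i = <⇒≱ (≤-<-trans d≤i i<A) (InSub⇒distα≥ Ri∈ eA ed)

        OutsideOrLater : ℕ → V⁺ → Set
        OutsideOrLater j u = ¬ InSub t u ⊎ ∃ λ j′ → j ≤ j′ × j′ ≤ B × u ≡ p j′

        -- R followed by P walked backwards from t to p j: the two parts meet only
        -- at t, since R stays outside T(t) before reaching it while P stays inside.
        detour : ∀ s j → s + j ≡ B → m < j →
                 Σ (AltPath (p j) (s + A)) λ D → ∀ {u} → u ∈ₚ D → OutsideOrLater j u
        detour zero j refl _ = retarget (sym end) R , R-vertices
          where
          R-vertices : ∀ {u} → u ∈ₚ R → OutsideOrLater B u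
          R-vertices (i , i≤A , Ri≡u) with m≤n⇒m<n∨m≡n i≤A
          ... | inj₁ i<A  = inj₁ (R-outside i i<A ∘ subst (InSub t) (sym Ri≡u))
          ... | inj₂ refl = inj₂ (B , ≤-refl , ≤-refl , trans (sym Ri≡u) (trans (AltPath.end R) (sym end)))
        detour (suc s) j s+1+j≡B m<j = step (detour s (suc j) s+j+1≡B (m<n⇒m<1+n m<j))
          where
          s+j+1≡B : s + suc j ≡ B
          s+j+1≡B = trans (+-suc s j) s+1+j≡B
          j<B : j < B
          j<B = subst (j <_) s+1+j≡B (s≤s (m≤n+m j s))
          step : Σ (AltPath (p (suc j)) (s + A)) (λ D → ∀ {u} → u ∈ₚ D → OutsideOrLater (suc j) u) →
                 Σ (AltPath (p j) (suc s + A)) λ D → ∀ {u} → u ∈ₚ D → OutsideOrLater j u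
          step (D , D-vertices) = snoc D adj ρ-edge pj∉D , vertices
            where
            adj : adj⁺ (p (suc j)) (p j) ≡ true
            adj = trans (adj⁺-sym (p (suc j)) (p j)) (edges j j<B)
            ρ-edge : ρ (p (suc j)) (p j) ≡ parity (s + A)
            ρ-edge = trans (ρ-sym (p (suc j)) (p j))
                           (trans (ρ-step P j j<B) (sym (parity-complement s j parity-B≡flip-A s+j+1≡B)))
            pj∉D : ¬ p j ∈ₚ D
            pj∉D pj∈D with D-vertices pj∈D
            ... | inj₁ pj∉ = pj∉ (later∈ j m<j (<⇒≤ j<B))
            ... | inj₂ (j′ , j<j′ , j′≤B , pj≡pj′) = <⇒≢ j<j′ (simple j j′ (<⇒≤ j<B) j′≤B pj≡pj′)
            vertices : ∀ {u} → u ∈ₚ snoc D adj ρ-edge pj∉D → OutsideOrLater j u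
            vertices u∈ with ∈ₚ-snoc D adj ρ-edge pj∉D u∈
            ... | inj₂ u≡pj = inj₂ (j , ≤-refl , <⇒≤ j<B , u≡pj)
            ... | inj₁ u∈D with D-vertices u∈D
            ...   | inj₁ u∉ = inj₁ u∉
            ...   | inj₂ (j′ , j<j′ , j′≤B , u≡pj′) = inj₂ (j′ , <⇒≤ j<j′ , j′≤B , u≡pj′)

        W : ℕ
        W = B ∸ suc m

        W+m+1≡B : W + suc m ≡ B
        W+m+1≡B = m∸n+n≡m m<B

        crossing-vlevel : ∀ {d₁ d₂} → d₁ ≤ m → d₂ ≤ W + A → d₁ + d₂ + 1 ≤ A + B
        crossing-vlevel {d₁} {d₂} d₁≤m d₂≤W+A = begin
          d₁ + d₂ + 1      ≤⟨ +-monoˡ-≤ 1 (+-mono-≤ d₁≤m d₂≤W+A) ⟩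
          m + (W + A) + 1  ≡⟨ solve 3 (λ m W A → m :+ (W :+ A) :+ con 1 := A :+ (W :+ (con 1 :+ m))) refl m W A ⟩
          A + (W + suc m)  ≡⟨ cong (A +_) W+m+1≡B ⟩
          A + B            ∎
          where
          open ≤-Reasoning
          open +-*-Solver

        crossing-hlevel : ∀ {d₁ d₂} → d₁ ≤ m → d₂ ≤ W + A → d₁ ⊔ d₂ < B
        crossing-hlevel d₁≤m d₂≤W+A =
          ⊔-lub (≤-<-trans d₁≤m m<B)
                (≤-<-trans d₂≤W+A (subst (W + A <_) W+m+1≡B (+-monoʳ-< W (s≤s A≤m))))

        incoming-below : ∃₂ λ b a → Incoming t b a × level b a <L (just (A + B) , just B)
        incoming-below =
          let (d₁ , e₁ , d₁≤m)   = dist≤length (prefix P m (<⇒≤ m<B))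
              (d₂ , e₂ , d₂≤W+A) = dist≤length (proj₁ (detour W (suc m) W+m+1≡B ≤-refl))
              e₂′ = subst (λ θ → dist θ (p (suc m)) ≡ just d₂)
                          (parity-complement W m parity-B≡flip-A W+m+1≡B) e₂
          in p m , p (suc m) , (edges m m<B , crossing-not-tree , inj₂ (pm∉ , pm+1∈)) ,
             subst (_<L _) (sym (level-finite ρ-crossing e₁ e₂′))
                   (≤-<⇒<L (crossing-vlevel d₁≤m d₂≤W+A) (crossing-hlevel d₁≤m d₂≤W+A))

        neighbour-bound : ∀ {y q} → adj⁺ y t ≡ true → ρ y t ≡ β t → dist (β t) y ≡ just q →
                          A ≤ q ⊎ (A ≡ suc q × EP t y)
        neighbour-bound {y} {q} adj ρ≡β eq =
          let (Q , parity-q) = shortest-path eq in via Q (trans ρ≡β (sym parity-q)) (t ∈ₚ? Q)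
          where
          via : (Q : AltPath y q) → ρ y t ≡ parity q → Dec (t ∈ₚ Q) → A ≤ q ⊎ (A ≡ suc q × EP t y)
          via Q _ (yes (i , i≤q , Qi≡t)) =
            inj₁ (<⇒≤ (≤-<-trans (A≤length (retarget Qi≡t (prefix Q i i≤q))) (≤∧≢⇒< i≤q i≢q)))
            where
            i≢q : i ≢ q
            i≢q refl = adj⁺⇒≢ adj (trans (sym (AltPath.end Q)) Qi≡t)
          via Q ρ-yt (no t∉Q) with m≤n⇒m<n∨m≡n (A≤length (snoc Q adj ρ-yt t∉Q))
          ... | inj₁ A<q+1 = inj₁ (s≤s⁻¹ A<q+1)
          ... | inj₂ A≡q+1 = inj₂ (A≡q+1 , q , trans eA (cong just A≡q+1) , snoc Q adj ρ-yt t∉Q ,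
                                   trans (extend-≤ Q {t} ≤-refl) (AltPath.end Q))

        edge-at-t-above : ∀ {y} → adj⁺ y t ≡ true → ρ y t ≡ β t → (just (A + B) , just B) ≤L level y t
        edge-at-t-above {y} adj ρ≡β with dist (β t) y in eq
        ... | nothing = subst (_ ≤L_) (sym (level-infinite ρ≡β eq)) (inj₁ fin<inf)
        ... | just q with neighbour-bound adj ρ≡β eq
        ...   | inj₁ A≤q = subst (_ ≤L_) (sym (level-finite ρ≡β eq eB))
                                 (inj₁ (fin<fin (≤-<-trans (+-monoˡ-≤ B A≤q) (m<m+n (q + B) z<s))))
        ...   | inj₂ (A≡q+1 , _) = subst (_ ≤L_) (sym (level-finite ρ≡β eq eB))
                                         (inj₂ (cong just (trans (cong (_+ B) A≡q+1) (+-comm 1 (q + B))) , fin≤fin (m≤n⊔m q B)))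

        edge-at-t-strictly-above : ∀ {y} → adj⁺ y t ≡ true → ρ y t ≡ β t → ¬ EP t y →
                                   just (A + B) <∞ vlevel y t
        edge-at-t-strictly-above {y} adj ρ≡β ¬ep with dist (β t) y in eq
        ... | nothing = subst (_ <∞_) (sym (cong proj₁ (level-infinite ρ≡β eq))) fin<inf
        ... | just q with neighbour-bound adj ρ≡β eq
        ...   | inj₁ A≤q = subst (_ <∞_) (sym (cong proj₁ (level-finite ρ≡β eq eB)))
                                 (fin<fin (≤-<-trans (+-monoˡ-≤ B A≤q) (m<m+n (q + B) z<s)))
        ...   | inj₂ (_ , ep) = contradiction ep ¬ep

lemma7 : ∀ {n} (G : Graph n) (M : Matching G) →
         let open Plus G M in
         (dist : Parity → V⁺ → ℕ∞) → (∀ θ x → IsDist θ x (dist θ x)) →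
         let open WithDist dist in
         (par : V⁺ → V⁺) → IsABT par →
         let open Tree par in
         (t : V⁺) → InT t → (∃ λ k → dist (β t) t ≡ just k) →
         (y : V⁺) → adj⁺ y t ≡ true → ¬ TreeEdge y t →
         (a* b* : V⁺) → MinIncoming t a* b* →
         (¬ (¬ EP t y × ρ y t ≡ α t) → level a* b* <L level y t) ×
         ((¬ EP t y × ρ y t ≡ β t) → vlevel a* b* <∞ vlevel y t)
lemma7 G M dist isDist par abt t (A , eA) (B , eB) y adj _ a* b* (_ , minimal) =
  (λ h → <L-≤L-trans e*-below (edge-at-t-above adj (ρ≡β-unless-α-edge h))) ,
  (λ (¬ep , ρ≡β) → ≤∞-<∞-trans (<L⇒vlevel-≤∞ e*-below) (edge-at-t-strictly-above adj ρ≡β ¬ep))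
  where
  open Plus G M
  open WithDist dist
  open Tree par
  open AugmentedGraph G M
  open Distances dist isDist
  open Subtrees par abt
  open AroundVertex eA eB

  e*-below : level a* b* <L (just (A + B) , just B)
  e*-below = let (b , a , incoming , below) = incoming-below in ≤L-<L-trans (minimal b a incoming) below
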